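{- Let $f > 1$ be an odd integer, let $e = \lfloor \log_2 f \rfloor$ (so that $2^e < f < 2^{e+1}$), and let $m$ be the multiplicative order of $2$ modulo $f$. Then for every integer $j \geq 1$, the number $\left\lfloor \frac{2^{jm+e}}{f} \right\rfloor$ is a binary $j$'th power whose canonical base-$2$ representation consists of $j$ repetitions of a block of length $m$; that is, $\left\lfloor \frac{2^{jm+e}}{f} \right\rfloor = a \cdot \frac{2^{jm}-1}{2^m-1}$ for some integer $a$ with $2^{m-1} \leq a < 2^m$.
   Context: A natural number is a binary $j$'th power if its canonical binary representation (no leading zeros) consists of $j$ consecutive identical blocks. -}

module Defs where

open import Data.Nat using (ℕ; _^_; _≤_; _<_; _%_; NonZero)
open import Relation.Binary.PropositionalEquality using (_≡_; _≢_)

record IsMultOrder2 (f : ℕ) .{{_ : NonZero f}} (m : ℕ) : Set where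
  field
    pos      : 1 ≤ m
    is-one   : (2 ^ m) % f ≡ 1 % f
    minimal  : ∀ k → 1 ≤ k → k < m → (2 ^ k) % f ≢ 1 % f

-- Write 2^m = 1 + c·f. Then 2^(jm) = 1 + c·f·R with R = 1 + 2^m + ⋯ + 2^((j-1)m),
-- so 2^(jm+e) = 2^e + (c·R·2^e)·f, and since 2^e < f the floor of 2^(jm+e)/f is
-- a·R with a = c·2^e, i.e. j copies of the m-bit block a. As 2^e ≤ f < 2^(e+1),
-- 2^(m-1) ≤ a < 2^m.
module Submission where

open import Defs
open import Data.Empty using (⊥-elim)
open import Data.Nat using (ℕ; NonZero; zero; suc; z≤n; s≤s; _+_; _*_; _∸_; _^_; _≤_; _<_; _/_; _%_; ⌊_/2⌋; ⌈_/2⌉)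
open import Data.Nat.DivMod using (m≡m%n+[m/n]*n; m<n⇒m%n≡m; +-distrib-/-∣ʳ; m<n⇒m/n≡0; m*n/n≡m)
open import Data.Nat.Divisibility using (divides)
open import Data.Nat.Logarithm using (⌊log₂_⌋; ⌊log₂⌋-mono-≤; ⌊log₂[2^n]⌋≡n)
open import Data.Nat.Logarithm.Core using (⌊log2⌋)
open import Data.Nat.Properties
open import Algebra.Properties.CommutativeSemigroup *-commutativeSemigroup using (x∙yz≈y∙xz; xy∙z≈xz∙y)
open import Data.Nat.Tactic.RingSolver using (solve-∀)
open import Data.Product using (Σ; _×_; _,_)
open import Induction.WellFounded using (acc)
open import Relation.Binary.PropositionalEquality
  using (_≡_; _≢_; refl; sym; trans; cong; cong₂; subst; module ≡-Reasoning)

2^⌊log2⌋≤n : ∀ n {ac} → 2 ^ ⌊log2⌋ (suc n) ac ≤ suc n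
2^⌊log2⌋≤n zero              = ≤-refl
2^⌊log2⌋≤n (suc n) {acc _} = begin
  2 * 2 ^ ⌊log2⌋ (suc h) _ ≤⟨ *-monoʳ-≤ 2 (2^⌊log2⌋≤n h) ⟩
  2 * suc h                ≡⟨ *-suc 2 h ⟩
  2 + 2 * h                ≤⟨ +-monoʳ-≤ 2 2*⌊n/2⌋≤n ⟩
  2 + n                    ∎
  where
  open ≤-Reasoning
  h = ⌊ n /2⌋
  2*⌊n/2⌋≤n : 2 * h ≤ n
  2*⌊n/2⌋≤n = begin
    2 * h         ≡⟨ cong (h +_) (+-identityʳ h) ⟩
    h + h         ≤⟨ +-monoʳ-≤ h (⌊n/2⌋≤⌈n/2⌉ n) ⟩
    h + ⌈ n /2⌉   ≡⟨ ⌊n/2⌋+⌈n/2⌉≡n n ⟩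
    n             ∎

2^⌊log₂n⌋≤n : ∀ n .{{_ : NonZero n}} → 2 ^ ⌊log₂ n ⌋ ≤ n
2^⌊log₂n⌋≤n (suc n) = 2^⌊log2⌋≤n n

n<2^[1+⌊log₂n⌋] : ∀ n → n < 2 ^ (1 + ⌊log₂ n ⌋)
n<2^[1+⌊log₂n⌋] n = ≰⇒> λ 2^[1+e]≤n →
  1+n≰n (subst (_≤ ⌊log₂ n ⌋) (⌊log₂[2^n]⌋≡n (1 + ⌊log₂ n ⌋)) (⌊log₂⌋-mono-≤ 2^[1+e]≤n))

2^k≢odd : ∀ k {n} → 1 < n → n % 2 ≡ 1 → 2 ^ k ≢ n
2^k≢odd zero    1<n _     1≡n = <-irrefl 1≡n 1<n
2^k≢odd (suc k) {n} _ n%2≡1 eq = even≢odd (2 ^ k) (n / 2) (begin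
  2 * 2 ^ k         ≡⟨ eq ⟩
  n                 ≡⟨ m≡m%n+[m/n]*n n 2 ⟩
  n % 2 + n / 2 * 2 ≡⟨ cong₂ _+_ n%2≡1 (*-comm (n / 2) 2) ⟩
  1 + 2 * (n / 2)   ∎)
  where open ≡-Reasoning

2^⌊log₂n⌋<n : ∀ n .{{_ : NonZero n}} → 1 < n → n % 2 ≡ 1 → 2 ^ ⌊log₂ n ⌋ < n
2^⌊log₂n⌋<n n 1<n n%2≡1 = ≤∧≢⇒< (2^⌊log₂n⌋≤n n) (2^k≢odd ⌊log₂ n ⌋ 1<n n%2≡1)

repunit : ℕ → ℕ → ℕ
repunit q zero    = 0
repunit q (suc j) = 1 + q * repunit q j

[1+d]^j≡1+d*repunit : ∀ d j → (1 + d) ^ j ≡ 1 + d * repunit (1 + d) j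
[1+d]^j≡1+d*repunit d zero    = cong suc (sym (*-zeroʳ d))
[1+d]^j≡1+d*repunit d (suc j) = begin
  (1 + d) * (1 + d) ^ j   ≡⟨ cong ((1 + d) *_) ([1+d]^j≡1+d*repunit d j) ⟩
  (1 + d) * (1 + d * r)   ≡⟨ expand d r ⟩
  1 + d * (1 + (1 + d) * r) ∎
  where
  open ≡-Reasoning
  r = repunit (1 + d) j
  expand : ∀ d r → (1 + d) * (1 + d * r) ≡ 1 + d * (1 + (1 + d) * r)
  expand = solve-∀

[1+d*n]*a/n≡d*a : ∀ d a n .{{_ : NonZero n}} → a < n → (1 + d * n) * a / n ≡ d * a
[1+d*n]*a/n≡d*a d a n a<n = begin
  (1 + d * n) * a / n       ≡⟨ cong (_/ n) (expand d n a) ⟩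
  (a + d * a * n) / n       ≡⟨ +-distrib-/-∣ʳ a (divides (d * a) refl) ⟩
  a / n + d * a * n / n     ≡⟨ cong₂ _+_ (m<n⇒m/n≡0 a<n) (m*n/n≡m (d * a) n) ⟩
  d * a                     ∎
  where
  open ≡-Reasoning
  expand : ∀ d n a → (1 + d * n) * a ≡ a + d * a * n
  expand = solve-∀

[1+c*n]^j*a/n*[c*n]≡c*a*[[1+c*n]^j∸1] : ∀ c n a j .{{_ : NonZero n}} → a < n →
  (1 + c * n) ^ j * a / n * (c * n) ≡ c * a * ((1 + c * n) ^ j ∸ 1)
[1+c*n]^j*a/n*[c*n]≡c*a*[[1+c*n]^j∸1] c n a j a<n = begin
  (1 + c * n) ^ j * a / n * (c * n) ≡⟨ cong (λ x → x * a / n * (c * n)) q^j≡1+c*n*r ⟩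
  (1 + c * n * r) * a / n * (c * n) ≡⟨ cong (λ x → (1 + x) * a / n * (c * n)) (xy∙z≈xz∙y c n r) ⟩
  (1 + c * r * n) * a / n * (c * n) ≡⟨ cong (_* (c * n)) ([1+d*n]*a/n≡d*a (c * r) a n a<n) ⟩
  c * r * a * (c * n)               ≡⟨ regroup c r a n ⟩
  c * a * (c * n * r)               ≡⟨ cong (λ x → c * a * (x ∸ 1)) (sym q^j≡1+c*n*r) ⟩
  c * a * ((1 + c * n) ^ j ∸ 1)     ∎
  where
  open ≡-Reasoning
  r = repunit (1 + c * n) j
  q^j≡1+c*n*r : (1 + c * n) ^ j ≡ 1 + c * n * r
  q^j≡1+c*n*r = [1+d]^j≡1+d*repunit (c * n) j
  regroup : ∀ c r a n → c * r * a * (c * n) ≡ c * a * (c * n * r)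
  regroup = solve-∀

-- c = 0 is excluded by parity; otherwise 1 + c·n ≤ c·(1 + n) ≤ c·2a.
2*p≡1+c*n⇒p≤c*a : ∀ {p n} c a → 2 * p ≡ 1 + c * n → n < 2 * a → p ≤ c * a
2*p≡1+c*n⇒p≤c*a {p}     zero          _ 2p≡1 _    = ⊥-elim (even≢odd p 0 2p≡1)
2*p≡1+c*n⇒p≤c*a {p} {n} c@(suc c-1) a eq   n<2a = *-cancelˡ-≤ 2 (begin
  2 * p       ≡⟨ eq ⟩
  1 + c * n   ≤⟨ +-monoˡ-≤ (c * n) (s≤s (z≤n {c-1})) ⟩
  c + c * n   ≡⟨ sym (*-suc c n) ⟩
  c * suc n   ≤⟨ *-monoʳ-≤ c n<2a ⟩
  c * (2 * a) ≡⟨ x∙yz≈y∙xz c 2 a ⟩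
  2 * (c * a) ∎)
  where open ≤-Reasoning

2*2^[m∸1]≡2^m : ∀ {m} → 1 ≤ m → 2 * 2 ^ (m ∸ 1) ≡ 2 ^ m
2*2^[m∸1]≡2^m (s≤s _) = refl

lemma12 : (f : ℕ) .{{_ : NonZero f}} → 1 < f → f % 2 ≡ 1 →
            (m : ℕ) → IsMultOrder2 f m →
            (j : ℕ) → 1 ≤ j →
            Σ ℕ (λ a → (2 ^ (m ∸ 1) ≤ a) × (a < 2 ^ m) ×
              ((2 ^ (j * m + ⌊log₂ f ⌋) / f) * (2 ^ m ∸ 1) ≡ a * (2 ^ (j * m) ∸ 1)))
lemma12 f 1<f f%2≡1 m order j _ = c * A , lower , upper , identity
  where
  open IsMultOrder2 order using (pos; is-one)
  open ≡-Reasoning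
  A = 2 ^ ⌊log₂ f ⌋
  c = 2 ^ m / f

  2^m≡1+c*f : 2 ^ m ≡ 1 + c * f
  2^m≡1+c*f = trans (m≡m%n+[m/n]*n (2 ^ m) f) (cong (_+ c * f) (trans is-one (m<n⇒m%n≡m 1<f)))

  2^[j*m]≡[1+c*f]^j : 2 ^ (j * m) ≡ (1 + c * f) ^ j
  2^[j*m]≡[1+c*f]^j = begin
    2 ^ (j * m)     ≡⟨ cong (2 ^_) (*-comm j m) ⟩
    2 ^ (m * j)     ≡⟨ sym (^-*-assoc 2 m j) ⟩
    (2 ^ m) ^ j     ≡⟨ cong (_^ j) 2^m≡1+c*f ⟩
    (1 + c * f) ^ j ∎

  identity : 2 ^ (j * m + ⌊log₂ f ⌋) / f * (2 ^ m ∸ 1) ≡ c * A * (2 ^ (j * m) ∸ 1)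
  identity = begin
    2 ^ (j * m + ⌊log₂ f ⌋) / f * (2 ^ m ∸ 1) ≡⟨ cong (λ x → x / f * (2 ^ m ∸ 1)) (^-distribˡ-+-* 2 (j * m) ⌊log₂ f ⌋) ⟩
    2 ^ (j * m) * A / f * (2 ^ m ∸ 1)         ≡⟨ cong₂ (λ x y → x * A / f * (y ∸ 1)) 2^[j*m]≡[1+c*f]^j 2^m≡1+c*f ⟩
    (1 + c * f) ^ j * A / f * (c * f)         ≡⟨ [1+c*n]^j*a/n*[c*n]≡c*a*[[1+c*n]^j∸1] c f A j (2^⌊log₂n⌋<n f 1<f f%2≡1) ⟩
    c * A * ((1 + c * f) ^ j ∸ 1)             ≡⟨ cong (λ x → c * A * (x ∸ 1)) (sym 2^[j*m]≡[1+c*f]^j) ⟩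
    c * A * (2 ^ (j * m) ∸ 1)                 ∎

  upper : c * A < 2 ^ m
  upper = subst (c * A <_) (sym 2^m≡1+c*f) (s≤s (*-monoʳ-≤ c (2^⌊log₂n⌋≤n f)))

  lower : 2 ^ (m ∸ 1) ≤ c * A
  lower = 2*p≡1+c*n⇒p≤c*a c A (trans (2*2^[m∸1]≡2^m pos) 2^m≡1+c*f) (n<2^[1+⌊log₂n⌋] f)
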